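{- Let $\theta>0$ and $n\ge1$. Under the Ewens-like distribution for records with parameter $\theta$ on $\mathfrak{S}_n$, for every integer $k\in[0,n-1]$, $$\mathbb{P}_n(\sigma(1)>k)=\frac{(n-1)!\,\theta^{(n-k)}}{(n-k-1)!\,\theta^{(n)}}.$$
   Context: $\mathfrak{S}_n$ is the set of permutations of $[n]=\{1,\dots,n\}$. A permutation $\sigma$ has a record at position $i$ if $\sigma(i)>\sigma(j)$ for all $j<i$; $\mathrm{rec}(\sigma)$ is the number of records. The Ewens-like distribution for records with parameter $\theta>0$ gives each $\sigma\in\mathfrak{S}_n$ probability proportional to $\theta^{\mathrm{rec}(\sigma)}$; $\mathbb{P}_n$ denotes probability under it. The rising factorial is $x^{(m)}=x(x+1)\cdots(x+m-1)$, $x^{(0)}=1$.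
   Formalization: The parameter θ ranges over the positive rationals instead of the positive reals. -}

module Defs where

open import Data.Nat as ℕ using (ℕ; zero; suc; _≤ᵇ_; _!)
open import Data.Bool using (Bool; true; false; if_then_else_)
open import Data.Fin as Fin using (Fin; toℕ)
open import Data.Vec as Vec using (Vec; []; _∷_; toList)
open import Data.List as List using (List; []; _∷_; allFin; concatMap; map; filter; foldr)
open import Data.List.Relation.Unary.Unique.Propositional using (Unique)
import Data.List.Relation.Unary.Unique.DecPropositional as UDec
open import Data.Integer using (+_)
open import Data.Rational as ℚ using (ℚ; 0ℚ; 1ℚ; _+_; _*_; _÷_; ≢-nonZero)
open import Relation.Nullary using (yes; no)

vecs : (n m : ℕ) → List (Vec (Fin n) m)
vecs n zero    = [] ∷ []
vecs n (suc m) = concatMap (λ i → map (i ∷_) (vecs n m)) (allFin n)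

-- 𝔖_n : the injective maps [n] → [n], in one-line notation σ(1) … σ(n)
-- (values are 0-based: the value j of the paper is stored as a Fin n with toℕ = j - 1)
perms : (n : ℕ) → List (Vec (Fin n) n)
perms n = filter (λ v → UDec.unique? (Fin._≟_ {n}) (toList v)) (vecs n n)

-- number of records: b is 1 + (maximum so far), 0 if no element seen yet;
-- x is a record iff x > every earlier value iff b ≤ x
recAux : ℕ → List ℕ → ℕ
recAux b []       = zero
recAux b (x ∷ xs) = if b ≤ᵇ x then suc (recAux (suc x) xs) else recAux b xs

rec : ∀ {n} → Vec (Fin n) n → ℕ
rec σ = recAux zero (map toℕ (toList σ))

-- σ(1) > k, with σ(1) = toℕ (first entry) + 1 in 1-based terms
firstGt : ∀ {n} → ℕ → Vec (Fin n) n → Bool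
firstGt k σ with toList σ
... | []    = false
... | x ∷ _ = k ≤ᵇ toℕ x

pow : ℚ → ℕ → ℚ
pow x zero    = 1ℚ
pow x (suc m) = x * pow x m

rising : ℚ → ℕ → ℚ
rising x zero    = 1ℚ
rising x (suc m) = rising x m * (x + (+ m) ℚ./ 1)

ℕtoℚ : ℕ → ℚ
ℕtoℚ m = (+ m) ℚ./ 1

-- total division (denominators used below are always nonzero)
_div_ : ℚ → ℚ → ℚ
p div q with q ℚ.≟ 0ℚ
... | yes _  = 0ℚ
... | no q≢0 = _÷_ p q {{≢-nonZero q≢0}}

weight : (n : ℕ) → ℚ → (Vec (Fin n) n → Bool) → ℚ
weight n θ E = foldr (λ σ acc → (if E σ then pow θ (rec σ) else 0ℚ) + acc) 0ℚ (perms n)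

Prob : (n : ℕ) → ℚ → (Vec (Fin n) n → Bool) → ℚ
Prob n θ E = weight n θ E div weight n θ (λ _ → true)

{-# OPTIONS --safe #-}
module Submission where

-- Generalise from permutations to arrangements of m distinct values drawn from a set p of
-- available values, with records counted against a threshold b (one more than the largest
-- value placed so far). Splitting on the first value gives a recurrence whose solution
-- depends only on m and on the number t of available values ≥ b: the weight is
-- (m!/t!) θ^(t), as only the relative order of those t candidates affects the records.
-- Hence all of 𝔖_n weighs θ^(n). If σ(1) = i + 1 > k, the remaining n - 1 values leave
-- n - 1 - i candidates, so the event weighs θ Σ_{j < n-k} ((n-1)!/j!) θ^(j), which
-- telescopes to ((n-1)!/(n-k-1)!) θ^(n-k).

open import Defs
open import Data.Nat using (ℕ; _≤_; _∸_; _!)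
open import Data.Rational using (ℚ; 0ℚ; _<_; _*_)
open import Relation.Binary.PropositionalEquality using (_≡_)

open import Data.Bool using (Bool; true; false; if_then_else_; not; _∧_; T)
open import Data.Bool.Properties using (T-∧; if-eta)
open import Data.Empty using (⊥-elim)
open import Data.Fin as Fin using (Fin; toℕ)
open import Data.Fin.Properties using (toℕ-injective)
import Data.Integer as ℤ
import Data.Integer.Properties as ℤ
open import Data.List using (List; []; _∷_; _++_; map; filter; foldr; concatMap; allFin; tabulate)
open import Data.List.Properties using (map-tabulate)
open import Data.List.Relation.Unary.All as All using (All; []; _∷_)
open import Data.List.Relation.Unary.AllPairs using ([]; _∷_)
open import Data.List.Relation.Unary.Unique.Propositional using (Unique)
open import Data.List.Relation.Unary.Unique.Propositional.Properties using (map⁺; map⁻)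
import Data.List.Relation.Unary.Unique.DecPropositional as UniqueDec
open import Data.Nat as ℕ using (suc; zero; z≤n; s≤s; _≤ᵇ_; _≡ᵇ_)
open import Data.Nat.Coprimality using (1-coprimeTo) renaming (sym to coprime-sym)
open import Data.Nat.DivMod using (n/n≡1; m/n*n≡m; *-/-assoc)
open import Data.Nat.Divisibility using (m≤n⇒m!∣n!)
open import Data.Nat.Properties as ℕ using (_!≢0)
open import Data.Product using (_×_; _,_; proj₁; proj₂)
open import Data.Rational as ℚ using (1ℚ; _+_; 1/_; Positive)
open import Data.Rational.Properties as ℚ using ()
open import Data.Rational.Solver using (module +-*-Solver)
open import Data.Vec using (Vec; _∷_; toList)
open import Function using (_∘_; const; Equivalence)
open import Relation.Binary.PropositionalEquality using (_≢_; refl; sym; cong; cong₂; trans; subst; module ≡-Reasoning)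
open import Relation.Nullary using (does; proof; yes; no)
open import Relation.Nullary.Reflects using (det; fromEquivalence; ofⁿ)
open import Relation.Unary using (Decidable)

open +-*-Solver
open ≡-Reasoning

-- Once ℕtoℚ m is rewritten to its normal form mkℚ (+ m) 0, the sum 1ℚ + ℕtoℚ m computes.
ℕtoℚ-suc : ∀ m → ℕtoℚ (suc m) ≡ 1ℚ + ℕtoℚ m
ℕtoℚ-suc m
  rewrite ℚ.normalize-coprime {m} {0} (coprime-sym (1-coprimeTo m))
  = sym (ℚ./-cong (cong (ℤ._+_ (ℤ.+ 1)) (ℤ.*-identityʳ (ℤ.+ m))) refl)

ℕtoℚ-+ : ∀ a b → ℕtoℚ (a ℕ.+ b) ≡ ℕtoℚ a + ℕtoℚ b
ℕtoℚ-+ zero    b = sym (ℚ.+-identityˡ (ℕtoℚ b))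
ℕtoℚ-+ (suc a) b = begin
  ℕtoℚ (suc (a ℕ.+ b))       ≡⟨ ℕtoℚ-suc (a ℕ.+ b) ⟩
  1ℚ + ℕtoℚ (a ℕ.+ b)        ≡⟨ cong (1ℚ +_) (ℕtoℚ-+ a b) ⟩
  1ℚ + (ℕtoℚ a + ℕtoℚ b)     ≡⟨ ℚ.+-assoc 1ℚ (ℕtoℚ a) (ℕtoℚ b) ⟨
  (1ℚ + ℕtoℚ a) + ℕtoℚ b     ≡⟨ cong (_+ ℕtoℚ b) (ℕtoℚ-suc a) ⟨
  ℕtoℚ (suc a) + ℕtoℚ b      ∎

ℕtoℚ-* : ∀ a b → ℕtoℚ (a ℕ.* b) ≡ ℕtoℚ a * ℕtoℚ b
ℕtoℚ-* zero    b = sym (ℚ.*-zeroˡ (ℕtoℚ b))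
ℕtoℚ-* (suc a) b = begin
  ℕtoℚ (b ℕ.+ a ℕ.* b)          ≡⟨ ℕtoℚ-+ b (a ℕ.* b) ⟩
  ℕtoℚ b + ℕtoℚ (a ℕ.* b)       ≡⟨ cong (ℕtoℚ b +_) (ℕtoℚ-* a b) ⟩
  ℕtoℚ b + ℕtoℚ a * ℕtoℚ b      ≡⟨ solve 2 (λ x y → y :+ x :* y := (con 1ℚ :+ x) :* y) refl (ℕtoℚ a) (ℕtoℚ b) ⟩
  (1ℚ + ℕtoℚ a) * ℕtoℚ b        ≡⟨ cong (_* ℕtoℚ b) (ℕtoℚ-suc a) ⟨
  ℕtoℚ (suc a) * ℕtoℚ b         ∎

sum< : ℕ → (ℕ → ℚ) → ℚ
sum< zero    f = 0ℚ
sum< (suc n) f = f 0 + sum< n (f ∘ suc)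

sum<-cong : ∀ n {f g : ℕ → ℚ} → (∀ i → i ℕ.< n → f i ≡ g i) → sum< n f ≡ sum< n g
sum<-cong zero    f≡g = refl
sum<-cong (suc n) f≡g = cong₂ _+_ (f≡g 0 (s≤s z≤n)) (sum<-cong n (λ i i<n → f≡g (suc i) (s≤s i<n)))

sum<-init-last : ∀ n (f : ℕ → ℚ) → sum< (suc n) f ≡ sum< n f + f n
sum<-init-last zero    f = ℚ.+-comm (f 0) 0ℚ
sum<-init-last (suc n) f = begin
  f 0 + sum< (suc n) (f ∘ suc)          ≡⟨ cong (f 0 +_) (sum<-init-last n (f ∘ suc)) ⟩
  f 0 + (sum< n (f ∘ suc) + f (suc n))  ≡⟨ ℚ.+-assoc (f 0) _ _ ⟨
  f 0 + sum< n (f ∘ suc) + f (suc n)    ∎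

sumList : {A : Set} → List A → (A → ℚ) → ℚ
sumList xs f = foldr (λ x acc → f x + acc) 0ℚ xs

sumList-cong : ∀ {A : Set} (xs : List A) {f g : A → ℚ} → (∀ x → f x ≡ g x) → sumList xs f ≡ sumList xs g
sumList-cong []       f≡g = refl
sumList-cong (x ∷ xs) f≡g = cong₂ _+_ (f≡g x) (sumList-cong xs f≡g)

sumList-zero : ∀ {A : Set} (xs : List A) → sumList xs (const 0ℚ) ≡ 0ℚ
sumList-zero []       = refl
sumList-zero (x ∷ xs) = trans (ℚ.+-identityˡ _) (sumList-zero xs)

*-distribˡ-sumList : ∀ {A : Set} c (xs : List A) f → c * sumList xs f ≡ sumList xs (λ x → c * f x)
*-distribˡ-sumList c []       f = ℚ.*-zeroʳ c
*-distribˡ-sumList c (x ∷ xs) f = trans (ℚ.*-distribˡ-+ c (f x) _) (cong (c * f x +_) (*-distribˡ-sumList c xs f))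

*-if-0 : ∀ c x q → c * (if x then q else 0ℚ) ≡ (if x then c * q else 0ℚ)
*-if-0 c true  q = refl
*-if-0 c false q = ℚ.*-zeroʳ c

sumList-++ : ∀ {A : Set} (xs ys : List A) f → sumList (xs ++ ys) f ≡ sumList xs f + sumList ys f
sumList-++ []       ys f = sym (ℚ.+-identityˡ _)
sumList-++ (x ∷ xs) ys f = trans (cong (f x +_) (sumList-++ xs ys f)) (sym (ℚ.+-assoc (f x) _ _))

sumList-filter : ∀ {A : Set} {P : A → Set} (P? : Decidable P) xs f →
                 sumList (filter P? xs) f ≡ sumList xs (λ x → if does (P? x) then f x else 0ℚ)
sumList-filter P? []       f = refl
sumList-filter P? (x ∷ xs) f with does (P? x)
... | true  = cong (f x +_) (sumList-filter P? xs f)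
... | false = trans (sumList-filter P? xs f) (sym (ℚ.+-identityˡ _))

sumList-map : ∀ {A B : Set} (h : A → B) xs f → sumList (map h xs) f ≡ sumList xs (f ∘ h)
sumList-map h []       f = refl
sumList-map h (x ∷ xs) f = cong (f (h x) +_) (sumList-map h xs f)

sumList-concatMap : ∀ {A B : Set} (h : A → List B) xs f → sumList (concatMap h xs) f ≡ sumList xs (λ x → sumList (h x) f)
sumList-concatMap h []       f = refl
sumList-concatMap h (x ∷ xs) f =
  trans (sumList-++ (h x) (concatMap h xs) f) (cong (sumList (h x) f +_) (sumList-concatMap h xs f))

sumList-allFin : ∀ n (g : ℕ → ℚ) → sumList (allFin n) (g ∘ toℕ) ≡ sum< n g
sumList-allFin zero    g = refl
sumList-allFin (suc n) g = cong (g 0 +_) (begin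
  sumList (tabulate {n = n} Fin.suc) (g ∘ toℕ)
    ≡⟨ cong (λ xs → sumList xs (g ∘ toℕ)) (map-tabulate {n = n} (λ i → i) Fin.suc) ⟨
  sumList (map Fin.suc (allFin n)) (g ∘ toℕ)
    ≡⟨ sumList-map Fin.suc (allFin n) (g ∘ toℕ) ⟩
  sumList (allFin n) (g ∘ suc ∘ toℕ)
    ≡⟨ sumList-allFin n (g ∘ suc) ⟩
  sum< n (g ∘ suc) ∎)

sumList-vecs-suc : ∀ n m (f : Vec (Fin n) (suc m) → ℚ) →
                   sumList (vecs n (suc m)) f ≡ sumList (allFin n) (λ i → sumList (vecs n m) (f ∘ (i ∷_)))
sumList-vecs-suc n m f = begin
  sumList (concatMap (λ i → map (i ∷_) (vecs n m)) (allFin n)) f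
    ≡⟨ sumList-concatMap (λ i → map (i ∷_) (vecs n m)) (allFin n) f ⟩
  sumList (allFin n) (λ i → sumList (map (i ∷_) (vecs n m)) f)
    ≡⟨ sumList-cong (allFin n) (λ i → sumList-map (i ∷_) (vecs n m) f) ⟩
  sumList (allFin n) (λ i → sumList (vecs n m) (f ∘ (i ∷_))) ∎

remove : ℕ → (ℕ → Bool) → ℕ → Bool
remove i p a = not (i ≡ᵇ a) ∧ p a

-- count≥ n p b = #{ i < n ∣ p i, b ≤ i } and count< n p b = #{ i < n ∣ p i, i < b }
count≥ : ℕ → (ℕ → Bool) → ℕ → ℕ
count≥ zero    p b       = 0
count≥ (suc n) p zero    = if p 0 then suc (count≥ n (p ∘ suc) 0) else count≥ n (p ∘ suc) 0
count≥ (suc n) p (suc b) = count≥ n (p ∘ suc) b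

count< : ℕ → (ℕ → Bool) → ℕ → ℕ
count< n       p zero    = 0
count< zero    p (suc b) = 0
count< (suc n) p (suc b) = if p 0 then suc (count< n (p ∘ suc) b) else count< n (p ∘ suc) b

count≥-split : ∀ n p b → count≥ n p 0 ≡ count< n p b ℕ.+ count≥ n p b
count≥-split zero    p zero    = refl
count≥-split zero    p (suc b) = refl
count≥-split (suc n) p zero    = refl
count≥-split (suc n) p (suc b) with p 0
... | true  = cong suc (count≥-split n (p ∘ suc) b)
... | false = count≥-split n (p ∘ suc) b

count≥-all : ∀ n b → count≥ n (const true) b ≡ n ∸ b
count≥-all zero    zero    = refl
count≥-all zero    (suc b) = refl
count≥-all (suc n) zero    = cong suc (count≥-all n zero)
count≥-all (suc n) (suc b) = count≥-all n b

count≥-remove-< : ∀ n p {i b} → i ℕ.< b → count≥ n (remove i p) b ≡ count≥ n p b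
count≥-remove-< zero    p                 _         = refl
count≥-remove-< (suc n) p {zero}  {suc b} _         = refl
count≥-remove-< (suc n) p {suc i} {suc b} (s≤s i<b) = count≥-remove-< n (p ∘ suc) i<b

count≥-remove-≥ : ∀ n p {i b} → b ≤ i → i ℕ.< n → p i ≡ true → suc (count≥ n (remove i p) b) ≡ count≥ n p b
count≥-remove-≥ (suc n) p {zero}  {zero}  _         _         pᵢ rewrite pᵢ = refl
count≥-remove-≥ (suc n) p {suc i} {zero}  _         (s≤s i<n) pᵢ with p 0
... | true  = cong suc (count≥-remove-≥ n (p ∘ suc) z≤n i<n pᵢ)
... | false = count≥-remove-≥ n (p ∘ suc) z≤n i<n pᵢ
count≥-remove-≥ (suc n) p {suc i} {suc b} (s≤s b≤i) (s≤s i<n) pᵢ = count≥-remove-≥ n (p ∘ suc) b≤i i<n pᵢ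

≤ᵇ-suc : ∀ b i → (suc b ≤ᵇ suc i) ≡ (b ≤ᵇ i)
≤ᵇ-suc zero    i = refl
≤ᵇ-suc (suc b) i = refl

byFirstValue : (ℕ → Bool) → ℕ → ℕ → ℚ → ℚ → ℚ
byFirstValue p b i ifRecord otherwise = if p i then (if b ≤ᵇ i then ifRecord else otherwise) else 0ℚ

-- The available values i ≥ b, read in increasing order, have count≥ n p b - 1, …, 1, 0
-- available values above them.
sum<-available : ∀ n p b (A : ℕ → ℚ) K →
  sum< n (λ i → byFirstValue p b i (A (count≥ n p (suc i))) K) ≡ sum< (count≥ n p b) A + ℕtoℚ (count< n p b) * K
sum<-available zero    p zero    A K = sym (trans (ℚ.+-identityˡ _) (ℚ.*-zeroˡ K))
sum<-available zero    p (suc b) A K = sym (trans (ℚ.+-identityˡ _) (ℚ.*-zeroˡ K))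
sum<-available (suc n) p zero    A K with p 0
... | true  = begin
  A c + sum< n _
    ≡⟨ cong (A c +_) (sum<-available n (p ∘ suc) 0 A K) ⟩
  A c + (sum< c A + ℕtoℚ 0 * K)
    ≡⟨ solve 3 (λ a s k → a :+ (s :+ con 0ℚ :* k) := (s :+ a) :+ con 0ℚ :* k) refl (A c) (sum< c A) K ⟩
  (sum< c A + A c) + ℕtoℚ 0 * K
    ≡⟨ cong (_+ ℕtoℚ 0 * K) (sum<-init-last c A) ⟨
  sum< (suc c) A + ℕtoℚ 0 * K ∎
  where c = count≥ n (p ∘ suc) 0
... | false = trans (ℚ.+-identityˡ _) (sum<-available n (p ∘ suc) 0 A K)
sum<-available (suc n) p (suc b) A K = begin
  first + sum< n (λ i → if p (suc i) then (if suc b ≤ᵇ suc i then A′ i else K) else 0ℚ)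
    ≡⟨ cong (first +_) (sum<-cong n (λ i _ → cong (λ x → if p (suc i) then (if x then A′ i else K) else 0ℚ)
                                                  (≤ᵇ-suc b i))) ⟩
  first + sum< n (λ i → byFirstValue (p ∘ suc) b i (A′ i) K)
    ≡⟨ cong (first +_) (sum<-available n (p ∘ suc) b A K) ⟩
  first + (sum< c A + ℕtoℚ d * K)
    ≡⟨ absorb (p 0) ⟩
  sum< c A + ℕtoℚ (if p 0 then suc d else d) * K ∎
  where
  first = if p 0 then K else 0ℚ
  A′ = λ i → A (count≥ n (p ∘ suc) (suc i))
  c = count≥ n (p ∘ suc) b
  d = count< n (p ∘ suc) b
  absorb : ∀ x → (if x then K else 0ℚ) + (sum< c A + ℕtoℚ d * K) ≡ sum< c A + ℕtoℚ (if x then suc d else d) * K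
  absorb true  = trans (solve 3 (λ k s e → k :+ (s :+ e :* k) := s :+ (con 1ℚ :+ e) :* k) refl K (sum< c A) (ℕtoℚ d))
                       (cong (λ e → sum< c A + e * K) (sym (ℕtoℚ-suc d)))
  absorb false = ℚ.+-identityˡ _

[_!/_!] : ℕ → ℕ → ℕ
[ m !/ t !] = (m ! ℕ./ t !) {{t !≢0}}

[1+m]!/t!≡[1+m]*[m!/t!] : ∀ {m t} → t ≤ m → [ suc m !/ t !] ≡ suc m ℕ.* [ m !/ t !]
[1+m]!/t!≡[1+m]*[m!/t!] {m} {t} t≤m = *-/-assoc (suc m) {{t !≢0}} (m≤n⇒m!∣n! t≤m)

m!/t!*t!≡m! : ∀ {m t} → t ≤ m → [ m !/ t !] ℕ.* t ! ≡ m !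
m!/t!*t!≡m! {m} {t} t≤m = m/n*n≡m {{t !≢0}} (m≤n⇒m!∣n! t≤m)

m!/t!≡[1+t]*[m!/[1+t]!] : ∀ {m t} → t ℕ.< m → [ m !/ t !] ≡ suc t ℕ.* [ m !/ suc t !]
m!/t!≡[1+t]*[m!/[1+t]!] {m} {t} t<m = ℕ.*-cancelʳ-≡ _ _ (t !) {{t !≢0}} (begin
  [ m !/ t !] ℕ.* t !      ≡⟨ m!/t!*t!≡m! (ℕ.<⇒≤ t<m) ⟩
  m !                      ≡⟨ m!/t!*t!≡m! t<m ⟨
  q ℕ.* (suc t ℕ.* t !)    ≡⟨ ℕ.*-assoc q (suc t) (t !) ⟨
  q ℕ.* suc t ℕ.* t !      ≡⟨ cong (ℕ._* t !) (ℕ.*-comm q (suc t)) ⟩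
  suc t ℕ.* q ℕ.* t !      ∎)
  where q = [ m !/ suc t !]

m!/u!+d*m!/[1+u]!≡[1+m]!/[1+u]! : ∀ {m u d} → d ℕ.+ u ≡ m →
                                   [ m !/ u !] ℕ.+ d ℕ.* [ m !/ suc u !] ≡ [ suc m !/ suc u !]
m!/u!+d*m!/[1+u]!≡[1+m]!/[1+u]! {m} {u} {zero} refl = begin
  [ u !/ u !] ℕ.+ 0      ≡⟨ ℕ.+-identityʳ _ ⟩
  [ u !/ u !]            ≡⟨ n/n≡1 (u !) {{u !≢0}} ⟩
  1                      ≡⟨ n/n≡1 (suc u !) {{suc u !≢0}} ⟨
  [ suc u !/ suc u !]    ∎
m!/u!+d*m!/[1+u]!≡[1+m]!/[1+u]! {m} {u} {suc d} d+u≡m = begin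
  [ m !/ u !] ℕ.+ suc d ℕ.* q    ≡⟨ cong (ℕ._+ suc d ℕ.* q) (m!/t!≡[1+t]*[m!/[1+t]!] u<m) ⟩
  suc u ℕ.* q ℕ.+ suc d ℕ.* q    ≡⟨ ℕ.*-distribʳ-+ q (suc u) (suc d) ⟨
  (suc u ℕ.+ suc d) ℕ.* q        ≡⟨ cong (λ e → suc e ℕ.* q) (trans (ℕ.+-comm u (suc d)) d+u≡m) ⟩
  suc m ℕ.* q                    ≡⟨ [1+m]!/t!≡[1+m]*[m!/t!] u<m ⟨
  [ suc m !/ suc u !]            ∎
  where
  q = [ m !/ suc u !]
  u<m : u ℕ.< m
  u<m = subst (u ℕ.<_) d+u≡m (ℕ.m<n+m u (s≤s z≤n))

values : ∀ {n m} → Vec (Fin n) m → List ℕ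
values v = map toℕ (toList v)

distinctIn : (ℕ → Bool) → List ℕ → Bool
distinctIn p []       = true
distinctIn p (x ∷ xs) = p x ∧ distinctIn (remove x p) xs

remove⇒ : ∀ {i p a} → T (remove i p a) → i ≢ a × T (p a)
remove⇒ {i} {a = a} t with i ≡ᵇ a | ℕ.≡⇒≡ᵇ i a
... | true  | _   = ⊥-elim t
... | false | i≢a = i≢a , t

⇒remove : ∀ {i p a} → i ≢ a → T (p a) → T (remove i p a)
⇒remove {i} {a = a} i≢a pₐ with i ≡ᵇ a | ℕ.≡ᵇ⇒≡ i a
... | true  | i≡a = ⊥-elim (i≢a (i≡a _))
... | false | _   = pₐ

distinctIn⇒ : ∀ p xs → T (distinctIn p xs) → All (T ∘ p) xs × Unique xs
distinctIn⇒ p []       _ = [] , []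
distinctIn⇒ p (x ∷ xs) t =
  let pₓ , rest = Equivalence.to T-∧ t
      ps , uniq = distinctIn⇒ (remove x p) xs rest
  in pₓ ∷ All.map (proj₂ ∘ remove⇒ {x} {p}) ps , All.map (proj₁ ∘ remove⇒ {x} {p}) ps ∷ uniq

⇒distinctIn : ∀ p xs → All (T ∘ p) xs → Unique xs → T (distinctIn p xs)
⇒distinctIn p []       _         _             = _
⇒distinctIn p (x ∷ xs) (pₓ ∷ ps) (x∉xs ∷ uniq) =
  Equivalence.from T-∧ (pₓ , ⇒distinctIn (remove x p) xs ps′ uniq)
  where ps′ = All.zipWith (λ (x≢y , py) → ⇒remove {p = p} x≢y py) (x∉xs , ps)

unique?≡distinctIn : ∀ {n} (xs : List (Fin n)) →
                     does (UniqueDec.unique? Fin._≟_ xs) ≡ distinctIn (const true) (map toℕ xs)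
unique?≡distinctIn xs = det (proof (UniqueDec.unique? Fin._≟_ xs)) (fromEquivalence
  (map⁻ ∘ proj₂ ∘ distinctIn⇒ (const true) (map toℕ xs))
  (⇒distinctIn (const true) (map toℕ xs) (All.universal _ _) ∘ map⁺ toℕ-injective))

module _ (θ : ℚ) where

  closedWeight : ℕ → ℕ → ℚ
  closedWeight m t = ℕtoℚ [ m !/ t !] * rising θ t

  sum<-θ*closedWeight : ∀ {m u} → u ≤ m →
                        sum< (suc u) (λ j → θ * closedWeight m j) ≡ ℕtoℚ [ m !/ u !] * rising θ (suc u)
  sum<-θ*closedWeight {m} {zero}  _     =
    solve 2 (λ t x → t :* (x :* con 1ℚ) :+ con 0ℚ := x :* (con 1ℚ :* (t :+ con 0ℚ))) refl θ (ℕtoℚ [ m !/ 0 !])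
  sum<-θ*closedWeight {m} {suc u} 1+u≤m = begin
    sum< (suc (suc u)) g
      ≡⟨ sum<-init-last (suc u) g ⟩
    sum< (suc u) g + g (suc u)
      ≡⟨ cong (_+ g (suc u)) (sum<-θ*closedWeight (ℕ.<⇒≤ 1+u≤m)) ⟩
    ℕtoℚ [ m !/ u !] * r + θ * (ℕtoℚ q * r)
      ≡⟨ cong (λ e → ℕtoℚ e * r + θ * (ℕtoℚ q * r)) (m!/t!≡[1+t]*[m!/[1+t]!] 1+u≤m) ⟩
    ℕtoℚ (suc u ℕ.* q) * r + θ * (ℕtoℚ q * r)
      ≡⟨ cong (λ e → e * r + θ * (ℕtoℚ q * r)) (ℕtoℚ-* (suc u) q) ⟩
    ℕtoℚ (suc u) * ℕtoℚ q * r + θ * (ℕtoℚ q * r)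
      ≡⟨ solve 4 (λ s x r t → s :* x :* r :+ t :* (x :* r) := x :* (r :* (t :+ s))) refl (ℕtoℚ (suc u)) (ℕtoℚ q) r θ ⟩
    ℕtoℚ q * rising θ (suc (suc u)) ∎
    where
    g = λ j → θ * closedWeight m j
    q = [ m !/ suc u !]
    r = rising θ (suc u)

  closedWeight-suc : ∀ {m} d t → d ℕ.+ t ≡ suc m →
                     sum< t (λ j → θ * closedWeight m j) + ℕtoℚ d * closedWeight m t ≡ closedWeight (suc m) t
  closedWeight-suc {m} d zero    d+0≡1+m = begin
    0ℚ + ℕtoℚ d * (ℕtoℚ x * 1ℚ)          ≡⟨ ℚ.+-identityˡ _ ⟩
    ℕtoℚ d * (ℕtoℚ x * 1ℚ)               ≡⟨ cong (λ e → ℕtoℚ e * (ℕtoℚ x * 1ℚ)) d≡1+m ⟩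
    ℕtoℚ (suc m) * (ℕtoℚ x * 1ℚ)         ≡⟨ ℚ.*-assoc (ℕtoℚ (suc m)) (ℕtoℚ x) 1ℚ ⟨
    ℕtoℚ (suc m) * ℕtoℚ x * 1ℚ           ≡⟨ cong (_* 1ℚ) (ℕtoℚ-* (suc m) x) ⟨
    ℕtoℚ (suc m ℕ.* x) * 1ℚ              ≡⟨ cong (λ e → ℕtoℚ e * 1ℚ) ([1+m]!/t!≡[1+m]*[m!/t!] {m} z≤n) ⟨
    closedWeight (suc m) 0               ∎
    where
    x = [ m !/ 0 !]
    d≡1+m = trans (sym (ℕ.+-identityʳ d)) d+0≡1+m
  closedWeight-suc {m} d (suc u) d+1+u≡1+m = begin
    sum< (suc u) (λ j → θ * closedWeight m j) + ℕtoℚ d * (ℕtoℚ q * r)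
      ≡⟨ cong (_+ ℕtoℚ d * (ℕtoℚ q * r)) (sum<-θ*closedWeight u≤m) ⟩
    ℕtoℚ [ m !/ u !] * r + ℕtoℚ d * (ℕtoℚ q * r)
      ≡⟨ solve 4 (λ x d y r → x :* r :+ d :* (y :* r) := (x :+ d :* y) :* r) refl
                 (ℕtoℚ [ m !/ u !]) (ℕtoℚ d) (ℕtoℚ q) r ⟩
    (ℕtoℚ [ m !/ u !] + ℕtoℚ d * ℕtoℚ q) * r
      ≡⟨ cong (_* r) (trans (ℕtoℚ-+ [ m !/ u !] (d ℕ.* q)) (cong (ℕtoℚ [ m !/ u !] +_) (ℕtoℚ-* d q))) ⟨
    ℕtoℚ ([ m !/ u !] ℕ.+ d ℕ.* q) * r
      ≡⟨ cong (λ e → ℕtoℚ e * r) (m!/u!+d*m!/[1+u]!≡[1+m]!/[1+u]! {m} {u} {d} d+u≡m) ⟩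
    closedWeight (suc m) (suc u) ∎
    where
    q = [ m !/ suc u !]
    r = rising θ (suc u)
    d+u≡m = ℕ.suc-injective (trans (sym (ℕ.+-suc d u)) d+1+u≡1+m)
    u≤m = subst (u ≤_) d+u≡m (ℕ.m≤n+m u d)

  -- p is the set of values still available and b the record threshold of recAux.
  recordWeight : (ℕ → Bool) → ℕ → List ℕ → ℚ
  recordWeight p b xs = if distinctIn p xs then pow θ (recAux b xs) else 0ℚ

  arrangementWeight : ℕ → ℕ → (ℕ → Bool) → ℕ → ℚ
  arrangementWeight n m p b = sumList (vecs n m) (recordWeight p b ∘ values)

  arrangementWeight-suc : ∀ n m p b → arrangementWeight n (suc m) p b ≡
    sum< n (λ i → byFirstValue p b i (θ * arrangementWeight n m (remove i p) (suc i))
                                     (arrangementWeight n m (remove i p) b))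
  arrangementWeight-suc n m p b =
    trans (sumList-vecs-suc n m (recordWeight p b ∘ values))
          (trans (sumList-allFin n (λ j → sumList (vecs n m) (λ w → recordWeight p b (j ∷ values w))))
                 (sum<-cong n (λ j _ → by-first-value j)))
    where
    by-first-value : ∀ j → sumList (vecs n m) (λ w → recordWeight p b (j ∷ values w))
                             ≡ byFirstValue p b j (θ * arrangementWeight n m (remove j p) (suc j))
                                                  (arrangementWeight n m (remove j p) b)
    by-first-value j with p j | b ≤ᵇ j
    ... | false | _     = sumList-zero (vecs n m)
    ... | true  | true  = trans (sumList-cong (vecs n m) (λ w → sym (*-if-0 θ (distinctIn (remove j p) (values w)) _)))
                                (sym (*-distribˡ-sumList θ (vecs n m) (recordWeight (remove j p) (suc j) ∘ values)))
    ... | true  | false = refl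

  arrangementWeight-closed : ∀ n m p b → count≥ n p 0 ≡ m →
                             arrangementWeight n m p b ≡ closedWeight m (count≥ n p b)
  arrangementWeight-remove : ∀ n m p {i c} → i ℕ.< n → p i ≡ true → count≥ n p 0 ≡ suc m → i ℕ.< c →
                             arrangementWeight n m (remove i p) c ≡ closedWeight m (count≥ n p c)

  arrangementWeight-closed n zero    p b #p≡0 = cong (closedWeight 0) (sym nothing-above-b)
    where nothing-above-b = ℕ.m+n≡0⇒n≡0 (count< n p b) (trans (sym (count≥-split n p b)) #p≡0)
  arrangementWeight-closed n (suc m) p b #p≡1+m = begin
    arrangementWeight n (suc m) p b
      ≡⟨ arrangementWeight-suc n m p b ⟩
    sum< n (λ i → byFirstValue p b i (θ * W (remove i p) (suc i)) (W (remove i p) b))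
      ≡⟨ sum<-cong n each ⟩
    sum< n (λ i → byFirstValue p b i (θ * closedWeight m (count≥ n p (suc i))) (closedWeight m t))
      ≡⟨ sum<-available n p b (λ j → θ * closedWeight m j) (closedWeight m t) ⟩
    sum< t (λ j → θ * closedWeight m j) + ℕtoℚ (count< n p b) * closedWeight m t
      ≡⟨ closedWeight-suc (count< n p b) t (trans (sym (count≥-split n p b)) #p≡1+m) ⟩
    closedWeight (suc m) t ∎
    where
    t = count≥ n p b
    W = arrangementWeight n m
    each : ∀ i → i ℕ.< n → byFirstValue p b i (θ * W (remove i p) (suc i)) (W (remove i p) b)
                          ≡ byFirstValue p b i (θ * closedWeight m (count≥ n p (suc i))) (closedWeight m t)
    each i i<n with p i in pᵢ | b ≤ᵇ i | ℕ.≤ᵇ-reflects-≤ b i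
    ... | false | _     | _       = refl
    ... | true  | true  | _       = cong (θ *_) (arrangementWeight-remove n m p i<n pᵢ #p≡1+m (ℕ.n<1+n i))
    ... | true  | false | ofⁿ b≰i = arrangementWeight-remove n m p i<n pᵢ #p≡1+m (ℕ.≰⇒> b≰i)

  arrangementWeight-remove n m p {i} {c} i<n pᵢ #p≡1+m i<c = begin
    arrangementWeight n m (remove i p) c
      ≡⟨ arrangementWeight-closed n m (remove i p) c (ℕ.suc-injective (trans (count≥-remove-≥ n p z≤n i<n pᵢ) #p≡1+m)) ⟩
    closedWeight m (count≥ n (remove i p) c)
      ≡⟨ cong (closedWeight m) (count≥-remove-< n p i<c) ⟩
    closedWeight m (count≥ n p c) ∎

  weight≡sumList-vecs : ∀ n E → weight n θ E ≡
    sumList (vecs n n) (λ v → if distinctIn (const true) (values v) then (if E v then pow θ (rec v) else 0ℚ) else 0ℚ)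
  weight≡sumList-vecs n E =
    trans (sumList-filter (λ v → UniqueDec.unique? Fin._≟_ (toList v)) (vecs n n) _)
          (sumList-cong (vecs n n) (λ v → cong (λ x → if x then (if E v then pow θ (rec v) else 0ℚ) else 0ℚ)
                                                (unique?≡distinctIn (toList v))))

  weight-all : ∀ n → weight n θ (const true) ≡ rising θ n
  weight-all n = begin
    weight n θ (const true)                        ≡⟨ weight≡sumList-vecs n (const true) ⟩
    arrangementWeight n n (const true) 0           ≡⟨ arrangementWeight-closed n n (const true) 0 (count≥-all n 0) ⟩
    closedWeight n (count≥ n (const true) 0)       ≡⟨ cong (closedWeight n) (count≥-all n 0) ⟩
    ℕtoℚ [ n !/ n !] * rising θ n                  ≡⟨ cong (λ e → ℕtoℚ e * rising θ n) (n/n≡1 (n !) {{n !≢0}}) ⟩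
    1ℚ * rising θ n                                ≡⟨ ℚ.*-identityˡ _ ⟩
    rising θ n                                     ∎

  weight-firstGt≡sum< : ∀ m k → weight (suc m) θ (firstGt k) ≡
    sum< (suc m) (λ j → if k ≤ᵇ j then θ * arrangementWeight (suc m) m (remove j (const true)) (suc j) else 0ℚ)
  weight-firstGt≡sum< m k = begin
    weight N θ (firstGt k)                                        ≡⟨ weight≡sumList-vecs N (firstGt k) ⟩
    sumList (vecs N N) f                                          ≡⟨ sumList-vecs-suc N m f ⟩
    sumList (allFin N) (λ i → sumList (vecs N m) (f ∘ (i ∷_)))   ≡⟨ sumList-cong (allFin N) by-first-value ⟩
    sumList (allFin N) (h ∘ toℕ)                                  ≡⟨ sumList-allFin N h ⟩
    sum< N h                                                      ∎
    where
    N = suc m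
    f : Vec (Fin N) N → ℚ
    f v = if distinctIn (const true) (values v) then (if firstGt k v then pow θ (rec v) else 0ℚ) else 0ℚ
    h : ℕ → ℚ
    h j = if k ≤ᵇ j then θ * arrangementWeight N m (remove j (const true)) (suc j) else 0ℚ
    by-first-value : ∀ i → sumList (vecs N m) (f ∘ (i ∷_)) ≡ h (toℕ i)
    by-first-value i with k ≤ᵇ toℕ i
    ... | true  = trans (sumList-cong (vecs N m) (λ w → sym (*-if-0 θ (distinctIn p (values w)) _)))
                        (sym (*-distribˡ-sumList θ (vecs N m) (recordWeight p (suc (toℕ i)) ∘ values)))
      where p = remove (toℕ i) (const true)
    ... | false = trans (sumList-cong (vecs N m) (λ w → if-eta (distinctIn (remove (toℕ i) (const true)) (values w))))
                        (sumList-zero (vecs N m))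

  weight-firstGt : ∀ {m k} → k ≤ m → weight (suc m) θ (firstGt k) ≡ ℕtoℚ [ m !/ m ∸ k !] * rising θ (suc (m ∸ k))
  weight-firstGt {m} {k} k≤m = begin
    weight N θ (firstGt k)
      ≡⟨ weight-firstGt≡sum< m k ⟩
    sum< N (λ j → if k ≤ᵇ j then θ * arrangementWeight N m (remove j (const true)) (suc j) else 0ℚ)
      ≡⟨ sum<-cong N closed ⟩
    sum< N (λ j → byFirstValue (const true) k j (g (count≥ N (const true) (suc j))) 0ℚ)
      ≡⟨ sum<-available N (const true) k g 0ℚ ⟩
    sum< (count≥ N (const true) k) g + ℕtoℚ (count< N (const true) k) * 0ℚ
      ≡⟨ cong₂ (λ c z → sum< c g + z) (count≥-all N k) (ℚ.*-zeroʳ (ℕtoℚ (count< N (const true) k))) ⟩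
    sum< (N ∸ k) g + 0ℚ                                ≡⟨ ℚ.+-identityʳ _ ⟩
    sum< (N ∸ k) g                                     ≡⟨ cong (λ c → sum< c g) (ℕ.+-∸-assoc 1 k≤m) ⟩
    sum< (suc (m ∸ k)) g                               ≡⟨ sum<-θ*closedWeight (ℕ.m∸n≤m m k) ⟩
    ℕtoℚ [ m !/ m ∸ k !] * rising θ (suc (m ∸ k))     ∎
    where
    N = suc m
    g = λ j → θ * closedWeight m j
    closed : ∀ j → j ℕ.< N → (if k ≤ᵇ j then θ * arrangementWeight N m (remove j (const true)) (suc j) else 0ℚ)
                           ≡ (if k ≤ᵇ j then g (count≥ N (const true) (suc j)) else 0ℚ)
    closed j j<N with k ≤ᵇ j
    ... | true  = cong (θ *_) (arrangementWeight-remove N m (const true) j<N refl (count≥-all N 0) (ℕ.n<1+n j))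
    ... | false = refl

div-cross : ∀ a b c d → b ≢ 0ℚ → d ≢ 0ℚ → a * d ≡ c * b → a div b ≡ c div d
div-cross a b c d b≢0 d≢0 ad≡cb with b ℚ.≟ 0ℚ | d ℚ.≟ 0ℚ
... | yes b≡0 | _       = ⊥-elim (b≢0 b≡0)
... | no _    | yes d≡0 = ⊥-elim (d≢0 d≡0)
... | no b≢0′ | no d≢0′ = begin
  a * b⁻¹                ≡⟨ ℚ.*-identityʳ _ ⟨
  a * b⁻¹ * 1ℚ           ≡⟨ cong (a * b⁻¹ *_) (ℚ.*-inverseʳ d {{ℚ.≢-nonZero d≢0′}}) ⟨
  a * b⁻¹ * (d * d⁻¹)    ≡⟨ solve 4 (λ a b′ d d′ → a :* b′ :* (d :* d′) := a :* d :* (b′ :* d′)) refl a b⁻¹ d d⁻¹ ⟩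
  a * d * (b⁻¹ * d⁻¹)    ≡⟨ cong (_* (b⁻¹ * d⁻¹)) ad≡cb ⟩
  c * b * (b⁻¹ * d⁻¹)    ≡⟨ solve 4 (λ c b b′ d′ → c :* b :* (b′ :* d′) := c :* d′ :* (b :* b′)) refl c b b⁻¹ d⁻¹ ⟩
  c * d⁻¹ * (b * b⁻¹)    ≡⟨ cong (c * d⁻¹ *_) (ℚ.*-inverseʳ b {{ℚ.≢-nonZero b≢0′}}) ⟩
  c * d⁻¹ * 1ℚ           ≡⟨ ℚ.*-identityʳ _ ⟩
  c * d⁻¹                ∎
  where
  b⁻¹ = (1/ b) {{ℚ.≢-nonZero b≢0′}}
  d⁻¹ = (1/ d) {{ℚ.≢-nonZero d≢0′}}

positive⇒≢0 : ∀ {p} → Positive p → p ≢ 0ℚ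
positive⇒≢0 {p} p>0 p≡0 = ℚ.<-irrefl (sym p≡0) (ℚ.positive⁻¹ p {{p>0}})

rising-positive : ∀ {θ} → Positive θ → ∀ t → Positive (rising θ t)
rising-positive θ>0 zero    = _
rising-positive {θ} θ>0 (suc t) = ℚ.pos*pos⇒pos (rising θ t) {{rising-positive θ>0 t}} (θ + ℕtoℚ t) {{θ+t>0}}
  where θ+t>0 = ℚ.pos+nonNeg⇒pos θ {{θ>0}} (ℕtoℚ t) {{ℚ.normalize-nonNeg t 1}}

ℕtoℚ-positive : ∀ m → .{{ℕ.NonZero m}} → Positive (ℕtoℚ m)
ℕtoℚ-positive m = ℚ.normalize-pos m 1

lemma3 : (θ : ℚ) → 0ℚ < θ → (n : ℕ) → 1 ≤ n → (k : ℕ) → k ≤ n ∸ 1 →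
           Prob n θ (firstGt k)
             ≡ (ℕtoℚ ((n ∸ 1) !) * rising θ (n ∸ k))
                 div (ℕtoℚ ((n ∸ k ∸ 1) !) * rising θ n)
lemma3 θ 0<θ (suc m) _ k k≤m rewrite ℕ.+-∸-assoc 1 k≤m = begin
  weight (suc m) θ (firstGt k) div weight (suc m) θ (const true)
    ≡⟨ cong₂ _div_ (weight-firstGt θ k≤m) (weight-all θ (suc m)) ⟩
  (ℕtoℚ [ m !/ u !] * r) div s
    ≡⟨ div-cross (ℕtoℚ [ m !/ u !] * r) s (ℕtoℚ (m !) * r) (ℕtoℚ (u !) * s)
                 (positive⇒≢0 s>0) (positive⇒≢0 u!s>0) cross ⟩
  (ℕtoℚ (m !) * r) div (ℕtoℚ (u !) * s) ∎
  where
  u = m ∸ k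
  r = rising θ (suc u)
  s = rising θ (suc m)
  s>0 = rising-positive (ℚ.positive 0<θ) (suc m)
  u!s>0 = ℚ.pos*pos⇒pos (ℕtoℚ (u !)) {{ℕtoℚ-positive (u !) {{u !≢0}}}} s {{s>0}}
  cross : ℕtoℚ [ m !/ u !] * r * (ℕtoℚ (u !) * s) ≡ ℕtoℚ (m !) * r * s
  cross = begin
    ℕtoℚ [ m !/ u !] * r * (ℕtoℚ (u !) * s)
      ≡⟨ solve 4 (λ x r f s → x :* r :* (f :* s) := x :* f :* r :* s) refl (ℕtoℚ [ m !/ u !]) r (ℕtoℚ (u !)) s ⟩
    ℕtoℚ [ m !/ u !] * ℕtoℚ (u !) * r * s
      ≡⟨ cong (λ e → e * r * s) (trans (sym (ℕtoℚ-* [ m !/ u !] (u !))) (cong ℕtoℚ (m!/t!*t!≡m! (ℕ.m∸n≤m m k)))) ⟩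
    ℕtoℚ (m !) * r * s ∎
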